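{- Let $r\ge 2$, let $\mathcal{H}$ be an $r$-uniform hypergraph, let $F$ be a graph, and let $G$ be the graph on $V(\mathcal{H})$ whose edges are the pairs $\{u,v\}$ contained in at least $\binom{r}{2}$ hyperedges of $\mathcal{H}$. If $G$ contains a copy of $F$, then $\mathcal{H}$ contains a Berge-$F$.
   Context: An $r$-uniform hypergraph consists of a vertex set and a set of $r$-element subsets (hyperedges). $\mathcal{H}$ contains a Berge-$F$ if there are an injection $\varphi:V(F)\to V(\mathcal{H})$ and an injection $f$ from $E(F)$ to the hyperedges of $\mathcal{H}$ with $\{\varphi(x),\varphi(y)\}\subseteq f(xy)$ for every edge $xy\in E(F)$. -}

module Defs where

open import Data.Nat using (ℕ; _≥_; _+_)
open import Data.Nat.Combinatorics using (_C_)
open import Data.Bool using (Bool; true; false; if_then_else_)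
open import Data.Fin using (Fin)
open import Data.Fin.Subset using (Subset; _∈_; ∣_∣)
open import Data.Fin.Subset.Properties using (_∈?_)
open import Data.Product using (_×_; Σ; _,_)
open import Data.Sum using (_⊎_)
open import Relation.Binary.PropositionalEquality using (_≡_; _≢_)
open import Relation.Nullary using (¬_; does)
open import Function.Definitions using (Injective)

-- An r-uniform hypergraph on vertex set Fin n with m hyperedges:
-- an injective family (so the hyperedges form a set) of r-element subsets.
record UniformHypergraph (r n : ℕ) : Set where
  field
    m        : ℕ
    edge     : Fin m → Subset n
    edge-inj : Injective _≡_ _≡_ edge
    uniform  : ∀ i → ∣ edge i ∣ ≡ r
open UniformHypergraph public

record Graph (k : ℕ) : Set where
  field
    adj      : Fin k → Fin k → Bool
    adj-sym  : ∀ x y → adj x y ≡ adj y x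
    adj-irr  : ∀ x → adj x x ≡ false
open Graph public

Edge : ∀ {k} → Graph k → Fin k → Fin k → Set
Edge F x y = adj F x y ≡ true

count : ∀ {m} → (Fin m → Bool) → ℕ
count {ℕ.zero}  P = 0
count {ℕ.suc m} P = (if P Fin.zero then 1 else 0) + count {m} (λ i → P (Fin.suc i))

codeg : ∀ {r n} → UniformHypergraph r n → Fin n → Fin n → ℕ
codeg H u v = count (λ i → does (u ∈? edge H i) Data.Bool.∧ does (v ∈? edge H i))
  where import Data.Bool

GEdge : ∀ {r n} → UniformHypergraph r n → Fin n → Fin n → Set
GEdge {r} H u v = u ≢ v × codeg H u v ≥ r C 2

ContainsCopy : ∀ {r n k} → UniformHypergraph r n → Graph k → Set
ContainsCopy {n = n} {k} H F =
  Σ (Fin k → Fin n) λ ψ → Injective _≡_ _≡_ ψ × (∀ x y → Edge F x y → GEdge H (ψ x) (ψ y))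

SamePair : ∀ {k} → Fin k → Fin k → Fin k → Fin k → Set
SamePair x y x' y' = (x ≡ x' × y ≡ y') ⊎ (x ≡ y' × y ≡ x')

-- An edge xy of F is
-- unordered, so f must assign the same hyperedge to (x,y) and (y,x).
ContainsBerge : ∀ {r n k} → UniformHypergraph r n → Graph k → Set
ContainsBerge {n = n} {k} H F =
  Σ (Fin k → Fin n) λ φ →
  Σ ((x y : Fin k) → Edge F x y → Fin (m H)) λ f →
    Injective _≡_ _≡_ φ
  × (∀ x y (e : Edge F x y) (e' : Edge F y x) → f x y e ≡ f y x e')
  × (∀ x y x' y' (e : Edge F x y) (e' : Edge F x' y') →
       f x y e ≡ f x' y' e' → SamePair x y x' y')
  × (∀ x y (e : Edge F x y) → (φ x ∈ edge H (f x y e)) × (φ y ∈ edge H (f x y e)))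

{-# OPTIONS --safe #-}
-- Form the bipartite graph whose left vertices are the edges xy of F and whose right
-- vertices are the hyperedges of H, xy being joined to e when ψ x, ψ y ∈ e.  A left
-- vertex has degree codeg(ψ x, ψ y) ≥ C(r,2), while a hyperedge meets ψ(V(F)) in at
-- most r vertices (ψ is injective) and so contains at most C(r,2) edges of F.  Double
-- counting therefore gives |N(X)| ≥ |X| for every set X of left vertices, and the
-- resulting matching saturating the left side is a Berge-F.  The matching is built by
-- augmenting paths: a search from an unmatched vertex that finds none would explore a set
-- X whose neighbours are all matched into X minus the start vertex.
module Submission where

open import Defs
open import Axiom.UniquenessOfIdentityProofs using (module Decidable⇒UIP)
open import Data.Bool using (Bool; true; false; if_then_else_; _∧_; not)
import Data.Bool as Bool
open import Data.Bool.Properties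
  using (not-injective; ∧-zeroʳ; ∧-identityʳ; ∧-conicalˡ; ∧-conicalʳ; ¬-not)
open import Data.Empty using (⊥-elim)
open import Data.Fin using (Fin; zero; suc; toℕ; splitAt; remQuot; combine)
open import Data.Fin.Permutation.Components using (transpose; transpose-inverse)
open import Data.Fin.Properties
  using (_≟_; _<?_; <-cmp; <-asym; suc-injective; any?; combine-injective; remQuot-combine)
open import Data.Fin.Subset using (Subset; _∈_; ∣_∣)
open import Data.Fin.Subset.Properties using (_∈?_)
open import Data.List using (List; []; _∷_; allFin)
open import Data.List.Membership.Propositional using () renaming (_∈_ to _∈ₗ_)
open import Data.List.Membership.Propositional.Properties using (∈-allFin)
open import Data.List.Relation.Unary.Any using (here; there)
open import Data.Maybe using (Maybe; just; nothing; is-just; maybe′; fromMaybe)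
open import Data.Maybe.Properties using (just-injective; ≡-dec)
open import Data.Nat
  using (ℕ; zero; suc; _+_; _*_; _≤_; _<_; _≥_; _≤′_; ≤′-refl; ≤′-step; z≤n; s≤s; >-nonZero)
open import Data.Nat.Combinatorics using (_C_; nCk+nC[k+1]≡[n+1]C[k+1]; nC1≡n)
open import Data.Nat.Induction using (<-wellFounded)
open import Data.Nat.Properties
  using (≤-refl; ≤-reflexive; ≤-trans; ≤⇒≤′; <⇒≱; n<1+n; m≤n⇒m≤1+n; m≤n+m; +-mono-≤;
         +-assoc; +-suc; +-identityʳ; *-suc; *-zeroʳ; *-cancelˡ-≤;
         +-0-commutativeMonoid; module ≤-Reasoning)
open import Algebra.Properties.CommutativeMonoid.Sum +-0-commutativeMonoid
  using (sum-syntax; ∑-comm; sum-cong-≗)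
open import Data.Product using (Σ-syntax; ∃-syntax; _×_; _,_; proj₁; proj₂; uncurry)
import Data.Product as Product
open import Data.Sum using (_⊎_; inj₁; inj₂; [_,_]′)
import Data.Sum as Sum
open import Data.Vec using ([]; _∷_)
open import Data.Vec.Functional using (updateAt)
open import Data.Vec.Functional.Properties using (updateAt-updates; updateAt-minimal)
open import Function using (id; _∘_; _∘₂_; case_of_)
open import Function.Definitions using (Injective)
open import Induction.WellFounded using (Acc; acc)
open import Relation.Binary.Definitions using (tri<; tri≈; tri>)
open import Relation.Binary.PropositionalEquality
open import Relation.Nullary using (¬_; Dec; does; yes; no)
open import Relation.Nullary.Decidable using (dec-true)

indicator : Bool → ℕ
indicator b = if b then 1 else 0

indicator-mono : ∀ {b c} → (b ≡ true → c ≡ true) → indicator b ≤ indicator c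
indicator-mono {false} b⇒c = z≤n
indicator-mono {true}  b⇒c rewrite b⇒c refl = ≤-refl

count≡∑ : ∀ {n} (P : Fin n → Bool) → count P ≡ ∑[ i < n ] indicator (P i)
count≡∑ {zero}  P = refl
count≡∑ {suc n} P = cong (indicator (P zero) +_) (count≡∑ (P ∘ suc))

count-cong : ∀ {n} {P Q : Fin n → Bool} → (∀ i → P i ≡ Q i) → count P ≡ count Q
count-cong {zero}  P≗Q = refl
count-cong {suc n} P≗Q = cong₂ _+_ (cong indicator (P≗Q zero)) (count-cong (P≗Q ∘ suc))

count-mono : ∀ {n} {P Q : Fin n → Bool} → (∀ i → P i ≡ true → Q i ≡ true) → count P ≤ count Q
count-mono {zero}  P⊆Q = z≤n
count-mono {suc n} P⊆Q = +-mono-≤ (indicator-mono (P⊆Q zero)) (count-mono (P⊆Q ∘ suc))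

count-none : ∀ {n} (P : Fin n → Bool) → (∀ i → P i ≡ false) → count P ≡ 0
count-none {zero}  P none = refl
count-none {suc n} P none rewrite none zero = count-none (P ∘ suc) (none ∘ suc)

count≤n : ∀ {n} (P : Fin n → Bool) → count P ≤ n
count≤n {zero}  P = z≤n
count≤n {suc n} P with P zero
... | true  = s≤s (count≤n (P ∘ suc))
... | false = m≤n⇒m≤1+n (count≤n (P ∘ suc))

count<n : ∀ {n} (P : Fin n → Bool) i → P i ≡ false → count P < n
count<n P zero    Pi≡false rewrite Pi≡false = s≤s (count≤n (P ∘ suc))
count<n P (suc i) Pi≡false with P zero
... | true  = s≤s (count<n (P ∘ suc) i Pi≡false)
... | false = m≤n⇒m≤1+n (count<n (P ∘ suc) i Pi≡false)

count-insert : ∀ {n} (P Q : Fin n → Bool) c → P c ≡ false → Q c ≡ true →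
               (∀ i → i ≢ c → P i ≡ Q i) → count Q ≡ suc (count P)
count-insert P Q zero    Pc Qc P≗Q rewrite Pc | Qc =
  cong suc (count-cong (λ i → sym (P≗Q (suc i) λ ())))
count-insert P Q (suc c) Pc Qc P≗Q =
  trans (cong₂ _+_ (cong indicator (sym (P≗Q zero λ ())))
                   (count-insert (P ∘ suc) (Q ∘ suc) c Pc Qc
                                 λ i i≢c → P≗Q (suc i) (i≢c ∘ suc-injective)))
        (+-suc (indicator (P zero)) (count (P ∘ suc)))

_∖_ : ∀ {n} → (Fin n → Bool) → Fin n → Fin n → Bool
(P ∖ c) i = P i ∧ not (does (i ≟ c))

count-∖ : ∀ {n} (P : Fin n → Bool) c → P c ≡ true → count P ≡ suc (count (P ∖ c))
count-∖ P c Pc = count-insert (P ∖ c) P c removed Pc kept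
  where
  removed : (P ∖ c) c ≡ false
  removed with c ≟ c
  ... | yes _   = ∧-zeroʳ (P c)
  ... | no c≢c = ⊥-elim (c≢c refl)
  kept : ∀ i → i ≢ c → (P ∖ c) i ≡ P i
  kept i i≢c with i ≟ c
  ... | yes i≡c = ⊥-elim (i≢c i≡c)
  ... | no _    = ∧-identityʳ (P i)

count-inj : ∀ {m n} (P : Fin m → Bool) (Q : Fin n → Bool) (g : Fin m → Fin n) →
            (∀ i → P i ≡ true → Q (g i) ≡ true) →
            (∀ {i i'} → P i ≡ true → P i' ≡ true → g i ≡ g i' → i ≡ i') →
            count P ≤ count Q
count-inj {zero}  P Q g maps inj = z≤n
count-inj {suc m} P Q g maps inj with P zero in P₀
... | false = count-inj (P ∘ suc) Q (g ∘ suc) (maps ∘ suc) (λ p p' → suc-injective ∘ inj p p')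
... | true  = begin
  suc (count (P ∘ suc))    ≤⟨ s≤s (count-inj (P ∘ suc) (Q ∖ g zero) (g ∘ suc) maps′
                                               (λ p p' → suc-injective ∘ inj p p')) ⟩
  suc (count (Q ∖ g zero)) ≡⟨ count-∖ Q (g zero) (maps zero P₀) ⟨
  count Q                  ∎
  where
  open ≤-Reasoning
  maps′ : ∀ i → P (suc i) ≡ true → (Q ∖ g zero) (g (suc i)) ≡ true
  maps′ i p with g (suc i) ≟ g zero
  ... | yes eq = case inj p P₀ eq of λ ()
  ... | no _   = trans (∧-identityʳ _) (maps (suc i) p)

∑-lower : ∀ {n} d (X : Fin n → Bool) (f : Fin n → ℕ) →
          (∀ i → X i ≡ true → d ≤ f i) → d * count X ≤ ∑[ i < n ] f i
∑-lower {zero}  d X f X⇒d≤f = ≤-reflexive (*-zeroʳ d)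
∑-lower {suc n} d X f X⇒d≤f with X zero in X₀
... | true  = begin
  d * suc (count (X ∘ suc))            ≡⟨ *-suc d _ ⟩
  d + d * count (X ∘ suc)              ≤⟨ +-mono-≤ (X⇒d≤f zero X₀)
                                                   (∑-lower d (X ∘ suc) (f ∘ suc) (X⇒d≤f ∘ suc)) ⟩
  f zero + ∑[ i < n ] f (suc i)        ∎
  where open ≤-Reasoning
... | false = ≤-trans (∑-lower d (X ∘ suc) (f ∘ suc) (X⇒d≤f ∘ suc)) (m≤n+m _ (f zero))

∑-upper : ∀ {n} d (Y : Fin n → Bool) (f : Fin n → ℕ) →
          (∀ j → f j ≤ d) → (∀ j → Y j ≡ false → f j ≡ 0) → ∑[ j < n ] f j ≤ d * count Y
∑-upper {zero}  d Y f f≤d outside = z≤n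
∑-upper {suc n} d Y f f≤d outside with Y zero in Y₀
... | true  = begin
  f zero + ∑[ j < n ] f (suc j)        ≤⟨ +-mono-≤ (f≤d zero)
                                                   (∑-upper d (Y ∘ suc) (f ∘ suc) (f≤d ∘ suc) (outside ∘ suc)) ⟩
  d + d * count (Y ∘ suc)              ≡⟨ *-suc d _ ⟨
  d * suc (count (Y ∘ suc))            ∎
  where open ≤-Reasoning
... | false rewrite outside zero Y₀ = ∑-upper d (Y ∘ suc) (f ∘ suc) (f≤d ∘ suc) (outside ∘ suc)

∑-count-comm : ∀ {a b} (E : Fin a → Fin b → Bool) →
               ∑[ i < a ] count (E i) ≡ ∑[ j < b ] count (λ i → E i j)
∑-count-comm {a} {b} E = begin
  ∑[ i < a ] count (E i)                       ≡⟨ sum-cong-≗ (count≡∑ ∘ E) ⟩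
  ∑[ i < a ] ∑[ j < b ] indicator (E i j)      ≡⟨ ∑-comm (λ i j → indicator (E i j)) ⟩
  ∑[ j < b ] ∑[ i < a ] indicator (E i j)      ≡⟨ sum-cong-≗ (λ j → count≡∑ (λ i → E i j)) ⟨
  ∑[ j < b ] count (λ i → E i j)               ∎
  where open ≡-Reasoning

count-splitAt : ∀ m {n} (Q : Fin m ⊎ Fin n → Bool) →
                count (Q ∘ splitAt m) ≡ count (Q ∘ inj₁) + count (Q ∘ inj₂)
count-splitAt zero    Q = refl
count-splitAt (suc m) Q =
  trans (cong (indicator (Q (inj₁ zero)) +_) (count-splitAt m (Q ∘ Sum.map₁ suc)))
        (sym (+-assoc (indicator (Q (inj₁ zero))) _ _))

count-remQuot : ∀ {m} k (Q : Fin m × Fin k → Bool) →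
                count (Q ∘ remQuot {m} k) ≡ ∑[ x < m ] count (λ y → Q (x , y))
count-remQuot {zero}  k Q = refl
count-remQuot {suc m} k Q = begin
  count (Q ∘ remQuot k)                                  ≡⟨ count-cong by-block ⟩
  count (Q′ ∘ splitAt k)                                 ≡⟨ count-splitAt k Q′ ⟩
  count (λ y → Q (zero , y)) + count (Q ∘ Product.map₁ suc ∘ remQuot {m} k)
                                                         ≡⟨ cong (count (λ y → Q (zero , y)) +_)
                                                                 (count-remQuot k (Q ∘ Product.map₁ suc)) ⟩
  ∑[ x < suc m ] count (λ y → Q (x , y))                 ∎
  where
  open ≡-Reasoning
  Q′ : Fin k ⊎ Fin (m * k) → Bool
  Q′ = [ (λ y → Q (zero , y)) , Q ∘ Product.map₁ suc ∘ remQuot {m} k ]′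
  by-block : ∀ i → Q (remQuot k i) ≡ Q′ (splitAt k i)
  by-block i with splitAt k i
  ... | inj₁ y = refl
  ... | inj₂ c = refl

count-∈ : ∀ {n} (S : Subset n) → count (λ v → does (v ∈? S)) ≡ ∣ S ∣
count-∈ []          = refl
count-∈ (true ∷ S)  = cong suc (count-∈ S)
count-∈ (false ∷ S) = count-∈ S

C2-suc : ∀ n → suc n C 2 ≡ n + n C 2
C2-suc n = trans (sym (nCk+nC[k+1]≡[n+1]C[k+1] n 1)) (cong (_+ n C 2) (nC1≡n n))

C2-mono : ∀ {m n} → m ≤ n → m C 2 ≤ n C 2
C2-mono m≤n = go (≤⇒≤′ m≤n)
  where
  go : ∀ {m n} → m ≤′ n → m C 2 ≤ n C 2
  go ≤′-refl            = ≤-refl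
  go (≤′-step {n} m≤′n) = ≤-trans (go m≤′n) (subst (n C 2 ≤_) (sym (C2-suc n)) (m≤n+m (n C 2) n))

pairs : ∀ {n} → (Fin n → Bool) → ℕ
pairs {n} T = ∑[ x < n ] count (λ y → does (x <? y) ∧ (T x ∧ T y))

pairs≡C2 : ∀ {n} (T : Fin n → Bool) → pairs T ≡ count T C 2
pairs≡C2 {zero}  T = refl
pairs≡C2 {suc n} T with T zero
... | true  = trans (cong (count (T ∘ suc) +_) (pairs≡C2 (T ∘ suc))) (sym (C2-suc (count (T ∘ suc))))
... | false = cong₂ _+_ (count-none (λ y → false ∧ T (suc y)) (λ _ → refl)) (pairs≡C2 (T ∘ suc))

neighbourhood-bound : ∀ {a b} (R : Fin a → Fin b → Bool) d (X : Fin a → Bool) (Y : Fin b → Bool) →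
                      (∀ i → X i ≡ true → d ≤ count (R i)) → (∀ j → count (λ i → R i j) ≤ d) →
                      (∀ i j → X i ≡ true → R i j ≡ true → Y j ≡ true) →
                      d * count X ≤ d * count Y
neighbourhood-bound {a} {b} R d X Y d≤deg deg≤d N[X]⊆Y = begin
  d * count X                     ≤⟨ ∑-lower d X (count ∘ E) d≤degX ⟩
  ∑[ i < a ] count (E i)          ≡⟨ ∑-count-comm E ⟩
  ∑[ j < b ] count (λ i → E i j)  ≤⟨ ∑-upper d Y _ degX≤d outside ⟩
  d * count Y                     ∎
  where
  open ≤-Reasoning
  E : Fin a → Fin b → Bool
  E i j = X i ∧ R i j
  d≤degX : ∀ i → X i ≡ true → d ≤ count (E i)
  d≤degX i Xi = subst (d ≤_) (count-cong λ j → cong (_∧ R i j) (sym Xi)) (d≤deg i Xi)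
  degX≤d : ∀ j → count (λ i → E i j) ≤ d
  degX≤d j = ≤-trans (count-mono λ i → ∧-conicalʳ (X i) (R i j)) (deg≤d j)
  outside : ∀ j → Y j ≡ false → count (λ i → E i j) ≡ 0
  outside j Yj = count-none _ λ i → ¬-not λ Eij →
    case trans (sym Yj) (N[X]⊆Y i j (∧-conicalˡ (X i) (R i j) Eij) (∧-conicalʳ (X i) (R i j) Eij)) of λ ()

module BipartiteMatching {a b : ℕ} (R : Fin a → Fin b → Bool) where

  Matching : Set
  Matching = Fin b → Maybe (Fin a)

  record IsMatching (M : Matching) : Set where
    field
      along     : ∀ {i j} → M j ≡ just i → R i j ≡ true
      injective : ∀ {i j j'} → M j ≡ just i → M j' ≡ just i → j ≡ j'
  open IsMatching

  Covered : Matching → Fin a → Set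
  Covered M i = ∃[ j ] M j ≡ just i

  _⊑_ : Matching → Matching → Set
  M ⊑ M' = ∀ {i} → Covered M i → Covered M' i

  Augmentation : Matching → Fin a → Set
  Augmentation M i₀ = Σ[ M' ∈ Matching ] IsMatching M' × M ⊑ M' × Covered M' i₀

  data AltPath (M : Matching) (i₀ : Fin a) : ℕ → Fin a → Set where
    []   : AltPath M i₀ 0 i₀
    step : ∀ {n i i'} → AltPath M i₀ n i → (j : Fin b) → R i j ≡ true → M j ≡ just i' →
           AltPath M i₀ (suc n) i'

  match-free : ∀ {M i j} → IsMatching M → ¬ Covered M i → R i j ≡ true → M j ≡ nothing →
               Augmentation M i
  match-free {M} {i} {j} V uncovered rij free =
    M' , isMatching , M⊑M' , (j , updateAt-updates j M)
    where
    M' : Matching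
    M' = updateAt M j (λ _ → just i)
    at : ∀ k → (k ≡ j × M' k ≡ just i) ⊎ (k ≢ j × M' k ≡ M k)
    at k with k ≟ j
    ... | yes refl = inj₁ (refl , updateAt-updates j M)
    ... | no k≢j   = inj₂ (k≢j , updateAt-minimal k j M k≢j)
    isMatching : IsMatching M'
    isMatching .along {j = k} M'k with at k
    ... | inj₁ (refl , M'j) = subst (λ i' → R i' j ≡ true) (just-injective (trans (sym M'j) M'k)) rij
    ... | inj₂ (_ , M'k≡Mk) = along V (trans (sym M'k≡Mk) M'k)
    isMatching .injective {j = k} {k'} M'k M'k' with at k | at k'
    ... | inj₁ (refl , _) | inj₁ (refl , _) = refl
    ... | inj₁ (refl , M'j) | inj₂ (_ , M'k'≡Mk') =
      ⊥-elim (uncovered (k' , trans (sym M'k'≡Mk') (trans M'k' (trans (sym M'k) M'j))))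
    ... | inj₂ (_ , M'k≡Mk) | inj₁ (refl , M'j) =
      ⊥-elim (uncovered (k , trans (sym M'k≡Mk) (trans M'k (trans (sym M'k') M'j))))
    ... | inj₂ (_ , M'k≡Mk) | inj₂ (_ , M'k'≡Mk') =
      injective V (trans (sym M'k≡Mk) M'k) (trans (sym M'k'≡Mk') M'k')
    M⊑M' : M ⊑ M'
    M⊑M' (k , Mk) with at k
    ... | inj₁ (refl , _)    = case trans (sym free) Mk of λ ()
    ... | inj₂ (_ , M'k≡Mk) = k , trans M'k≡Mk Mk

  -- Moving i from j' to the free vertex j is the matching M ∘ transpose j j'.
  module Rematch {M i j j'} (V : IsMatching M) (rij : R i j ≡ true)
                 (free : M j ≡ nothing) (j'↦i : M j' ≡ just i) where

    M₁ : Matching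
    M₁ = M ∘ transpose j j'

    transpose-at : ∀ k → (k ≡ j × transpose j j' k ≡ j') ⊎ (k ≡ j' × transpose j j' k ≡ j)
                                                         ⊎ (k ≢ j × k ≢ j' × transpose j j' k ≡ k)
    transpose-at k with k ≟ j
    ... | yes k≡j = inj₁ (k≡j , refl)
    ... | no k≢j with k ≟ j'
    ...   | yes k≡j' = inj₂ (inj₁ (k≡j' , refl))
    ...   | no k≢j'  = inj₂ (inj₂ (k≢j , k≢j' , refl))

    moved : ∀ k {l w} → transpose j j' k ≡ l → M₁ k ≡ just w → M l ≡ just w
    moved k t≡l M₁k = trans (cong M (sym t≡l)) M₁k

    isMatching₁ : IsMatching M₁
    isMatching₁ .along {j = k} M₁k with transpose-at k
    ... | inj₁ (refl , t≡j') =
      subst (λ i' → R i' j ≡ true) (just-injective (trans (sym j'↦i) (moved j t≡j' M₁k))) rij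
    ... | inj₂ (inj₁ (refl , t≡j))  = case trans (sym free) (moved j' t≡j M₁k) of λ ()
    ... | inj₂ (inj₂ (_ , _ , t≡k)) = along V (moved k t≡k M₁k)
    isMatching₁ .injective {j = k} {k'} M₁k M₁k' = begin
      k                                     ≡⟨ transpose-inverse j' j ⟨
      transpose j' j (transpose j j' k)     ≡⟨ cong (transpose j' j) (injective V M₁k M₁k') ⟩
      transpose j' j (transpose j j' k')    ≡⟨ transpose-inverse j' j ⟩
      k'                                    ∎
      where open ≡-Reasoning

    M⊑M₁ : M ⊑ M₁
    M⊑M₁ (k , Mk) = transpose j' j k , trans (cong M (transpose-inverse j j')) Mk

    uncovered₁ : ∀ {i₀} → ¬ Covered M i₀ → ¬ Covered M₁ i₀
    uncovered₁ uncovered (k , M₁k) = uncovered (transpose j j' k , M₁k)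

    freed : M₁ j' ≡ nothing
    freed with transpose-at j'
    ... | inj₁ (refl , t≡j)           = trans (cong M t≡j) free
    ... | inj₂ (inj₁ (_ , t≡j))       = trans (cong M t≡j) free
    ... | inj₂ (inj₂ (_ , j'≢j' , _)) = ⊥-elim (j'≢j' refl)

    unchanged : ∀ {k w} → M k ≡ just w → w ≢ i → M₁ k ≡ just w
    unchanged {k} Mk w≢i with transpose-at k
    ... | inj₁ (refl , _)            = case trans (sym free) Mk of λ ()
    ... | inj₂ (inj₁ (refl , _))     = ⊥-elim (w≢i (just-injective (trans (sym Mk) j'↦i)))
    ... | inj₂ (inj₂ (_ , _ , t≡k))  = trans (cong M t≡k) Mk

  cut-or-transport : ∀ {M M₁ i₀ n w} v → (∀ {k u} → M k ≡ just u → u ≢ v → M₁ k ≡ just u) →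
                     AltPath M i₀ n w → (∃[ m ] m ≤ n × AltPath M i₀ m v) ⊎ AltPath M₁ i₀ n w
  cut-or-transport v unchanged [] = inj₂ []
  cut-or-transport v unchanged (step {i' = w} p j rij Mj) with cut-or-transport v unchanged p
  ... | inj₁ (m , m≤n , q) = inj₁ (m , m≤n⇒m≤1+n m≤n , q)
  ... | inj₂ p₁ with w ≟ v
  ...   | yes refl = inj₁ (_ , ≤-refl , step p j rij Mj)
  ...   | no w≢v   = inj₂ (step p₁ j rij (unchanged Mj w≢v))

  -- Flip the last edge of the path; the rest of the path either avoids its endpoint i,
  -- and survives the flip, or visits i earlier and can be cut there.
  augment : ∀ {M i₀ n i j} → Acc _<_ n → IsMatching M → ¬ Covered M i₀ →
            AltPath M i₀ n i → R i j ≡ true → M j ≡ nothing → Augmentation M i₀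
  augment _ V uncovered [] rij free = match-free V uncovered rij free
  augment {M} {i₀} {suc n} {i} (acc smaller) V uncovered (step {i = i'} p j' ri'j' j'↦i) rij free =
    [ shortcut , detour ]′ (cut-or-transport i unchanged p)
    where
    open Rematch V rij free j'↦i
    shortcut : ∃[ m ] m ≤ n × AltPath M i₀ m i → Augmentation M i₀
    shortcut (m , m≤n , q) = augment (smaller (s≤s m≤n)) V uncovered q rij free
    detour : AltPath M₁ i₀ n i' → Augmentation M i₀
    detour p₁ with augment (smaller ≤-refl) isMatching₁ (uncovered₁ uncovered) p₁ ri'j' freed
    ... | M' , V' , M₁⊑M' , covered = M' , V' , M₁⊑M' ∘ M⊑M₁ , covered

  module Saturation (P : Fin a → Bool) (d : ℕ) (1≤d : 1 ≤ d)
                    (R⊆P : ∀ {i j} → R i j ≡ true → P i ≡ true)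
                    (d≤deg : ∀ i → P i ≡ true → d ≤ count (R i))
                    (deg≤d : ∀ j → count (λ i → R i j) ≤ d) where

    path-in-P : ∀ {M i₀ n i} → IsMatching M → P i₀ ≡ true → AltPath M i₀ n i → P i ≡ true
    path-in-P V Pi₀ []                = Pi₀
    path-in-P V Pi₀ (step _ j _ Mj)   = R⊆P (along V Mj)

    Exploration : Matching → Fin a → Set
    Exploration M i₀ = (i : Fin a) → Maybe (∃[ n ] AltPath M i₀ n i)

    module _ {M : Matching} {i₀ : Fin a} where

      reached : Exploration M i₀ → Fin a → Bool
      reached S i = is-just (S i)

      path-to : (S : Exploration M i₀) → ∀ i → reached S i ≡ true → ∃[ n ] AltPath M i₀ n i
      path-to S i reached-i with S i
      ... | just q = q

      extend : Exploration M i₀ → ∀ w → ∃[ n ] AltPath M i₀ n w → Exploration M i₀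
      extend S w q i with i ≟ w
      ... | yes refl = just q
      ... | no _     = S i

      extend-mono : ∀ S w q {i} → reached S i ≡ true → reached (extend S w q) i ≡ true
      extend-mono S w q {i} reached-i with i ≟ w
      ... | yes refl = refl
      ... | no _     = reached-i

      extend-new : ∀ S w q → reached (extend S w q) w ≡ true
      extend-new S w q with w ≟ w
      ... | yes refl = refl
      ... | no w≢w   = ⊥-elim (w≢w refl)

      count-extend : ∀ S w q → reached S w ≡ false →
                     count (reached (extend S w q)) ≡ suc (count (reached S))
      count-extend S w q unreached =
        count-insert (reached S) (reached (extend S w q)) w unreached (extend-new S w q) unchanged
        where
        unchanged : ∀ i → i ≢ w → reached S i ≡ reached (extend S w q) i
        unchanged i i≢w with i ≟ w
        ... | yes i≡w = ⊥-elim (i≢w i≡w)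
        ... | no _    = refl

    module _ {M i₀} (V : IsMatching M) (uncovered : ¬ Covered M i₀) (Pi₀ : P i₀ ≡ true) where

      partner-reached : Exploration M i₀ → Fin b → Bool
      partner-reached S j = maybe′ (reached S) false (M j)

      -- The neighbours of a closed exploration X are matched injectively into X ∖ i₀.
      not-closed : ∀ S → reached S i₀ ≡ true →
                   ¬ (∀ i j → reached S i ≡ true → R i j ≡ true → partner-reached S j ≡ true)
      not-closed S S∋i₀ closed = <⇒≱ fewer-partners (*-cancelˡ-≤ d {{>-nonZero 1≤d}} degree-count)
        where
        X = reached S
        Y = partner-reached S
        degree-count : d * count X ≤ d * count Y
        degree-count = neighbourhood-bound R d X Y
          (λ i Xi → d≤deg i (path-in-P V Pi₀ (proj₂ (path-to S i Xi)))) deg≤d closed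
        partner : Fin b → Fin a
        partner j = fromMaybe i₀ (M j)
        partner∈X∖i₀ : ∀ j → Y j ≡ true → (X ∖ i₀) (partner j) ≡ true
        partner∈X∖i₀ j Yj with M j in Mj
        ... | just w with w ≟ i₀
        ...   | yes refl = ⊥-elim (uncovered (j , Mj))
        ...   | no _     = trans (∧-identityʳ (X w)) Yj
        partner-inj : ∀ {j j'} → Y j ≡ true → Y j' ≡ true → partner j ≡ partner j' → j ≡ j'
        partner-inj {j} {j'} Yj Yj' eq with M j in Mj | M j' in Mj'
        ... | just w | just w' = injective V Mj (trans Mj' (cong just (sym eq)))
        fewer-partners : count Y < count X
        fewer-partners = begin-strict
          count Y               ≤⟨ count-inj Y (X ∖ i₀) partner partner∈X∖i₀ partner-inj ⟩
          count (X ∖ i₀)        <⟨ n<1+n _ ⟩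
          suc (count (X ∖ i₀))  ≡⟨ count-∖ X i₀ S∋i₀ ⟨
          count X               ∎
          where open ≤-Reasoning

      frontier-edge : Exploration M i₀ → Fin a → Fin b → Bool
      frontier-edge S i j = reached S i ∧ R i j ∧ not (partner-reached S j)

      -- Each step either augments or reaches a new vertex, so a steps suffice.
      explore : ∀ fuel S → reached S i₀ ≡ true → a ≤ count (reached S) + fuel → Augmentation M i₀
      advance : ∀ fuel S → reached S i₀ ≡ true → a ≤ count (reached S) + fuel →
                ∀ {n i j} → AltPath M i₀ n i → R i j ≡ true → partner-reached S j ≡ false →
                Augmentation M i₀

      explore fuel S S∋i₀ budget with any? (λ i → any? (λ j → frontier-edge S i j Bool.≟ true))
      ... | yes (i , j , leaving) = advance fuel S S∋i₀ budget (proj₂ (path-to S i Xi)) Rij Yj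
        where
        Xi  = ∧-conicalˡ (reached S i) _ leaving
        Rij = ∧-conicalˡ (R i j) _ (∧-conicalʳ (reached S i) _ leaving)
        Yj  = not-injective (∧-conicalʳ (R i j) _ (∧-conicalʳ (reached S i) _ leaving))
      ... | no none = ⊥-elim (not-closed S S∋i₀ closed)
        where
        closed : ∀ i j → reached S i ≡ true → R i j ≡ true → partner-reached S j ≡ true
        closed i j Xi Rij with partner-reached S j in Yj
        ... | true  = refl
        ... | false = ⊥-elim (none (i , j , leaving))
          where leaving : frontier-edge S i j ≡ true
                leaving rewrite Xi | Rij | Yj = refl

      advance fuel S S∋i₀ budget {n} {j = j} p Rij Yj with M j in Mj
      ... | nothing = augment (<-wellFounded n) V uncovered p Rij Mj
      ... | just w with fuel
      ...   | zero = ⊥-elim (<⇒≱ (count<n (reached S) w Yj) (subst (a ≤_) (+-identityʳ _) budget))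
      ...   | suc fuel = explore fuel S′ (extend-mono S w q S∋i₀) budget′
        where
        q = suc n , step p j Rij Mj
        S′ = extend S w q
        budget′ : a ≤ count (reached S′) + fuel
        budget′ = subst (a ≤_) (trans (+-suc _ fuel) (cong (_+ fuel) (sym (count-extend S w q Yj))))
                        budget

    start : ∀ {M} i₀ → Exploration M i₀
    start i₀ = extend (λ _ → nothing) i₀ (0 , [])

    cover : (L : List (Fin a)) →
            Σ[ M ∈ Matching ] IsMatching M × (∀ {i} → i ∈ₗ L → P i ≡ true → Covered M i)
    cover [] = (λ _ → nothing) , record { along = λ () ; injective = λ () } , λ ()
    cover (i ∷ L) with cover L
    ... | M , V , covers with P i Bool.≟ true | any? (λ j → ≡-dec _≟_ (M j) (just i))
    ...   | no ¬Pi | _ = M , V , λ { (here refl) Pi → ⊥-elim (¬Pi Pi) ; (there i∈L) → covers i∈L }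
    ...   | yes _  | yes covered = M , V , λ { (here refl) _ → covered ; (there i∈L) → covers i∈L }
    ...   | yes Pi | no uncovered with explore V uncovered Pi a (start i) (extend-new _ i _) (m≤n+m a _)
    ...     | M' , V' , M⊑M' , covered =
      M' , V' , λ { (here refl) _ → covered ; (there i∈L) → M⊑M' ∘ covers i∈L }

    saturating-matching : Σ[ g ∈ (∀ i → P i ≡ true → Fin b) ]
                            (∀ i Pi → R i (g i Pi) ≡ true)
                          × (∀ {i i'} Pi Pi' → g i Pi ≡ g i' Pi' → i ≡ i')
    saturating-matching = g , along V ∘₂ partner , λ Pi Pi' g≡g →
      just-injective (trans (sym (partner _ Pi)) (trans (cong M g≡g) (partner _ Pi')))
      where
      M = proj₁ (cover (allFin a))
      V = proj₁ (proj₂ (cover (allFin a)))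
      matched : ∀ i → P i ≡ true → Covered M i
      matched i = proj₂ (proj₂ (cover (allFin a))) (∈-allFin i)
      g : ∀ i → P i ≡ true → Fin b
      g i Pi = proj₁ (matched i Pi)
      partner : ∀ i Pi → M (g i Pi) ≡ just i
      partner i Pi = proj₂ (matched i Pi)

module _ {k : ℕ} where

  SamePair-sym : {x y u v : Fin k} → SamePair x y u v → SamePair u v x y
  SamePair-sym (inj₁ (refl , refl)) = inj₁ (refl , refl)
  SamePair-sym (inj₂ (refl , refl)) = inj₂ (refl , refl)

  SamePair-trans : {x y u v s t : Fin k} → SamePair x y u v → SamePair u v s t → SamePair x y s t
  SamePair-trans (inj₁ (refl , refl)) uv~st               = uv~st
  SamePair-trans (inj₂ (refl , refl)) (inj₁ (refl , refl)) = inj₂ (refl , refl)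
  SamePair-trans (inj₂ (refl , refl)) (inj₂ (refl , refl)) = inj₁ (refl , refl)

  SamePair-both : ∀ (Q : Fin k → Set) {x y u v} → SamePair x y u v → Q u × Q v → Q x × Q y
  SamePair-both Q (inj₁ (refl , refl)) (Qu , Qv) = Qu , Qv
  SamePair-both Q (inj₂ (refl , refl)) (Qu , Qv) = Qv , Qu

  increasing-unique : ∀ {u v u' v' : Fin k} → toℕ u < toℕ v → toℕ u' < toℕ v' →
                      SamePair u v u' v' → (u , v) ≡ (u' , v')
  increasing-unique _   _     (inj₁ (refl , refl)) = refl
  increasing-unique u<v v<u (inj₂ (refl , refl)) = ⊥-elim (<-asym u<v v<u)

  sort : Fin k → Fin k → Fin k × Fin k
  sort x y with <-cmp x y
  ... | tri> _ _ _ = y , x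
  ... | _          = x , y

  sort-SamePair : ∀ x y → SamePair x y (proj₁ (sort x y)) (proj₂ (sort x y))
  sort-SamePair x y with <-cmp x y
  ... | tri< _ _ _ = inj₁ (refl , refl)
  ... | tri≈ _ _ _ = inj₁ (refl , refl)
  ... | tri> _ _ _ = inj₂ (refl , refl)

  sort-increasing : ∀ {x y} → x ≢ y → toℕ (proj₁ (sort x y)) < toℕ (proj₂ (sort x y))
  sort-increasing {x} {y} x≢y with <-cmp x y
  ... | tri< x<y _ _ = x<y
  ... | tri≈ _ x≡y _ = ⊥-elim (x≢y x≡y)
  ... | tri> _ _ y<x = y<x

  sort-comm : ∀ {x y} → x ≢ y → sort x y ≡ sort y x
  sort-comm {x} {y} x≢y = increasing-unique (sort-increasing x≢y) (sort-increasing (x≢y ∘ sym))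
    (SamePair-trans (SamePair-sym (sort-SamePair x y))
                    (SamePair-trans (inj₂ (refl , refl)) (sort-SamePair y x)))

module _ {k} (F : Graph k) where

  edge-≢ : ∀ {x y} → Edge F x y → x ≢ y
  edge-≢ {x} xy refl = case trans (sym xy) (adj-irr F x) of λ ()

  SamePair-Edge : ∀ {x y u v} → SamePair x y u v → Edge F x y → Edge F u v
  SamePair-Edge         (inj₁ (refl , refl)) xy = xy
  SamePair-Edge {x} {y} (inj₂ (refl , refl)) xy = trans (adj-sym F y x) xy

witness : ∀ {A : Set} (a? : Dec A) → does a? ≡ true → A
witness (yes a) _ = a

module CopyToBerge {r n k} (H : UniformHypergraph r n) (F : Graph k) (r≥2 : r ≥ 2)
                   (ψ : Fin k → Fin n) (ψ-inj : Injective _≡_ _≡_ ψ)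
                   (ψ-edges : ∀ x y → Edge F x y → GEdge H (ψ x) (ψ y)) where

  inside : Fin (m H) → Fin k → Bool
  inside e x = does (ψ x ∈? edge H e)

  -- The left vertices are the codes in Fin (k * k) of increasing pairs of adjacent vertices.
  isEdge : Fin k × Fin k → Bool
  isEdge (u , v) = adj F u v ∧ does (u <? v)

  incident : Fin k × Fin k → Fin (m H) → Bool
  incident (u , v) e = isEdge (u , v) ∧ (inside e u ∧ inside e v)

  inside-count : ∀ e → count (inside e) ≤ r
  inside-count e = subst (count (inside e) ≤_) (trans (count-∈ (edge H e)) (uniform H e))
                         (count-inj (inside e) (λ v → does (v ∈? edge H e)) ψ (λ _ → id) (λ _ _ → ψ-inj))

  incident-count : ∀ p → isEdge p ≡ true → r C 2 ≤ count (incident p)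
  incident-count (u , v) uv =
    subst (r C 2 ≤_) (count-cong λ e → cong (_∧ (inside e u ∧ inside e v)) (sym uv))
                     (proj₂ (ψ-edges u v (∧-conicalˡ _ _ uv)))

  hyperedge-load : ∀ e → count (λ c → incident (remQuot k c) e) ≤ r C 2
  hyperedge-load e = begin
    count (λ c → incident (remQuot k c) e)   ≤⟨ count-mono (ordered ∘ remQuot k) ⟩
    count (Ordered ∘ remQuot k)              ≡⟨ count-remQuot k Ordered ⟩
    pairs (inside e)                         ≡⟨ pairs≡C2 (inside e) ⟩
    count (inside e) C 2                     ≤⟨ C2-mono (inside-count e) ⟩
    r C 2                                    ∎
    where
    open ≤-Reasoning
    Ordered : Fin k × Fin k → Bool
    Ordered (u , v) = does (u <? v) ∧ (inside e u ∧ inside e v)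
    ordered : ∀ p → incident p e ≡ true → Ordered p ≡ true
    ordered (u , v) with adj F u v | does (u <? v)
    ... | true | true = id

  open BipartiteMatching (λ c → incident (remQuot k c))
  open Saturation (isEdge ∘ remQuot k) (r C 2) (C2-mono r≥2)
                  (λ {c} → ∧-conicalˡ (isEdge (remQuot k c)) _) (incident-count ∘ remQuot k) hyperedge-load

  code : Fin k → Fin k → Fin (k * k)
  code x y = uncurry combine (sort x y)

  decode-code : ∀ x y → remQuot k (code x y) ≡ sort x y
  decode-code x y = remQuot-combine (proj₁ (sort x y)) (proj₂ (sort x y))

  code-isEdge : ∀ {x y} → Edge F x y → isEdge (remQuot k (code x y)) ≡ true
  code-isEdge {x} {y} xy = subst (λ p → isEdge p ≡ true) (sym (decode-code x y))
    (cong₂ _∧_ (SamePair-Edge F (sort-SamePair x y) xy)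
               (dec-true (_ <? _) (sort-increasing (edge-≢ F xy))))

  g : ∀ c → isEdge (remQuot k c) ≡ true → Fin (m H)
  g = proj₁ saturating-matching

  g-incident : ∀ c p → incident (remQuot k c) (g c p) ≡ true
  g-incident = proj₁ (proj₂ saturating-matching)

  g-injective : ∀ {c c'} p p' → g c p ≡ g c' p' → c ≡ c'
  g-injective = proj₂ (proj₂ saturating-matching)

  g-cong : ∀ {c c'} p p' → c ≡ c' → g c p ≡ g c' p'
  g-cong p p' refl = cong (g _) (Decidable⇒UIP.≡-irrelevant Bool._≟_ p p')

  f : ∀ x y → Edge F x y → Fin (m H)
  f x y xy = g (code x y) (code-isEdge xy)

  f-sym : ∀ x y (xy : Edge F x y) (yx : Edge F y x) → f x y xy ≡ f y x yx
  f-sym x y xy yx = g-cong _ _ (cong (uncurry combine) (sort-comm (edge-≢ F xy)))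

  f-inj : ∀ x y x' y' (xy : Edge F x y) (x'y' : Edge F x' y') →
          f x y xy ≡ f x' y' x'y' → SamePair x y x' y'
  f-inj x y x' y' xy x'y' eq with combine-injective _ _ _ _ (g-injective _ _ eq)
  ... | u≡u' , v≡v' = SamePair-trans (sort-SamePair x y)
                        (SamePair-trans (inj₁ (u≡u' , v≡v')) (SamePair-sym (sort-SamePair x' y')))

  f-covers : ∀ x y (xy : Edge F x y) → (ψ x ∈ edge H (f x y xy)) × (ψ y ∈ edge H (f x y xy))
  f-covers x y xy = SamePair-both (λ z → ψ z ∈ edge H e) (sort-SamePair x y)
                                  (witness (_ ∈? _) ∈u , witness (_ ∈? _) ∈v)
    where
    e = f x y xy
    incident-e : incident (sort x y) e ≡ true
    incident-e = subst (λ p → incident p e ≡ true) (decode-code x y)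
                       (g-incident (code x y) (code-isEdge xy))
    u = proj₁ (sort x y)
    v = proj₂ (sort x y)
    inside-uv = ∧-conicalʳ (isEdge (u , v)) _ incident-e
    ∈u = ∧-conicalˡ (inside e u) _ inside-uv
    ∈v = ∧-conicalʳ (inside e u) _ inside-uv

lemma8 : (r : ℕ) → r ≥ 2 → (n : ℕ) (H : UniformHypergraph r n) (k : ℕ) (F : Graph k) →
         ContainsCopy H F → ContainsBerge H F
lemma8 r r≥2 n H k F (ψ , ψ-inj , ψ-edges) = ψ , f , ψ-inj , f-sym , f-inj , f-covers
  where open CopyToBerge H F r≥2 ψ ψ-inj ψ-edges
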